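{- Let $n \geq 6$ be an integer and let $G$ be a graph on $n$ vertices with minimum degree at least $n - 2$. If $T$ is a tree on $n$ vertices not isomorphic to $K_{1, n-1}$, then $G$ contains a subgraph isomorphic to $T$. -}

module Defs where

open import Data.Nat using (ℕ; zero; suc; _+_; _≤_; _∸_)
open import Data.Fin using (Fin; zero; suc)
open import Data.Bool using (Bool; true; false; if_then_else_)
open import Data.List using (List; []; _∷_; length; filter; head)
open import Data.List.Relation.Unary.Unique.Propositional using (Unique)
open import Data.List.Relation.Unary.Linked using (Linked)
open import Data.Maybe using (Maybe; just; nothing)
open import Data.Product using (Σ; _×_; ∃)
open import Function.Definitions using (Injective)
open import Relation.Binary.PropositionalEquality using (_≡_)
open import Relation.Nullary using (¬_)
import Data.List as L

record Graph (n : ℕ) : Set where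
  field
    adj    : Fin n → Fin n → Bool
    sym    : ∀ u v → adj u v ≡ adj v u
    irrefl : ∀ v → adj v v ≡ false
open Graph public

Adj : ∀ {n} → Graph n → Fin n → Fin n → Set
Adj G u v = adj G u v ≡ true

countB : ∀ {n} → (Fin n → Bool) → ℕ
countB {zero}  p = 0
countB {suc n} p = (if p zero then 1 else 0) + countB (λ i → p (suc i))

degree : ∀ {n} → Graph n → Fin n → ℕ
degree G v = countB (adj G v)

MinDegree≥ : ∀ {n} → Graph n → ℕ → Set
MinDegree≥ G d = ∀ v → d ≤ degree G v

record Walk {n} (G : Graph n) (u v : Fin n) : Set where
  field
    rest  : List (Fin n)        -- vertices after u; the last vertex of u ∷ rest is v
    links : Linked (Adj G) (u ∷ rest)
    ends  : L.last (u ∷ rest) ≡ just v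
open Walk public

Connected : ∀ {n} → Graph n → Set
Connected G = ∀ u v → Walk G u v

-- A cycle: a list of k ≥ 3 distinct vertices v₁ … v_k with consecutive
-- ones adjacent and v_k adjacent to v₁.
record Cycle {n} (G : Graph n) : Set where
  field
    first : Fin n
    rest  : List (Fin n)
    long  : 2 ≤ length rest
    dist  : Unique (first ∷ rest)
    links : Linked (Adj G) (first ∷ rest)
    close : ∀ w → L.last rest ≡ just w → Adj G w first
open Cycle public

Acyclic : ∀ {n} → Graph n → Set
Acyclic G = ¬ Cycle G

IsTree : ∀ {n} → Graph n → Set
IsTree G = Connected G × Acyclic G

record _≅_ {n} (G H : Graph n) : Set where
  field
    to      : Fin n → Fin n
    from    : Fin n → Fin n
    from∘to : ∀ v → from (to v) ≡ v
    to∘from : ∀ v → to (from v) ≡ v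
    pres    : ∀ u v → adj H (to u) (to v) ≡ adj G u v
open _≅_ public

-- The star K_{1,n-1} on Fin (suc m): centre zero adjacent to all other vertices.
starAdj : ∀ {m} → Fin (suc m) → Fin (suc m) → Bool
starAdj zero    zero    = false
starAdj zero    (suc _) = true
starAdj (suc _) zero    = true
starAdj (suc _) (suc _) = false

star : ∀ m → Graph (suc m)
star m = record { adj = starAdj ; sym = s ; irrefl = i }
  where
    s : ∀ u v → starAdj u v ≡ starAdj v u
    s zero zero = _≡_.refl
    s zero (suc _) = _≡_.refl
    s (suc _) zero = _≡_.refl
    s (suc _) (suc _) = _≡_.refl
    i : ∀ v → starAdj v v ≡ false
    i zero = _≡_.refl
    i (suc _) = _≡_.refl

ContainsCopy : ∀ {m n} → Graph n → Graph m → Set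
ContainsCopy G H = Σ (_ → _) λ f → Injective _≡_ _≡_ f × (∀ u v → Adj H u v → Adj G (f u) (f v))

{-# OPTIONS --safe #-}
module Submission where

open import Defs
open import Algebra.Definitions using (Involutive)
open import Data.Bool using (Bool; true; false; _∨_)
open import Data.Bool.Properties using (¬-not; not-¬) renaming (_≟_ to _≟ᵇ_)
open import Data.Empty using (⊥)
open import Data.Fin using (Fin; zero; suc)
open import Data.Fin.Permutation
  using (Permutation′; _⟨$⟩ʳ_; _⟨$⟩ˡ_; inverseˡ; inverseʳ; id; transpose; _∘ₚ_)
import Data.Fin.Permutation.Components as PC
open import Data.Fin.Properties using (_≟_; any?)
open import Data.List using (List; []; _∷_; length)
open import Data.List.Membership.Propositional using (_∈_; _∉_)
open import Data.List.Relation.Unary.All as All using (All; []; _∷_)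
open import Data.List.Relation.Unary.AllPairs using ([]; _∷_)
open import Data.List.Relation.Unary.Any using (here; there)
open import Data.List.Relation.Unary.Linked using ([-]; _∷_)
open import Data.List.Relation.Unary.Unique.Propositional using (Unique)
open import Data.Nat using (ℕ; zero; suc; _+_; _∸_; _≤_; _<_; z≤n; s≤s)
open import Data.Nat.Induction using (<-wellFounded)
open import Data.Nat.Properties using (m≤n⇒m≤1+n; +-monoʳ-<; m≤n+m∸n; n≮n; module ≤-Reasoning)
open import Data.Product using (∃; _×_; _,_; proj₁; proj₂)
open import Data.Sum using (_⊎_; inj₁; inj₂; swap; map₂)
open import Function using (_∘_)
open import Induction.WellFounded using (Acc; acc)
open import Relation.Binary.PropositionalEquality as ≡
  using (_≡_; _≢_; refl; trans; cong; cong₂; subst; ≢-sym; module ≡-Reasoning)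
open import Relation.Nullary using (¬_; Dec; yes; no; does; contradiction)
open import Relation.Nullary.Decidable using (dec-true; dec-false; ¬?; _×-dec_)

-- The non-edges of G form a matching, encoded by an involution `partner` that fixes the
-- vertices adjacent to all others. A bijection π from the vertices of G to those of T
-- yields a copy of T in G as soon as no vertex x is in conflict, i.e. π x and
-- π (partner x) are never adjacent in T. A conflict u = π x, v = π (partner x) can always
-- be removed without creating new ones. Either some w can swap places with partner x,
-- or every w is blocked; then, as no vertex of T is adjacent to all others, u and v have
-- further neighbours a = π z and b = π t, and sending x, partner x, z, t to a, b, v, u
-- works because T has neither triangles nor 4-cycles. So the number of conflicts can be
-- driven down to zero.

countB-mono : ∀ {n} {r s : Fin n → Bool} → (∀ i → r i ≡ true → s i ≡ true) → countB r ≤ countB s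
countB-mono {zero} r⊆s = z≤n
countB-mono {suc n} {r} {s} r⊆s with r zero in r₀ | s zero in s₀
... | true  | true  = s≤s (countB-mono (r⊆s ∘ suc))
... | true  | false = contradiction (r⊆s zero r₀) (not-¬ s₀)
... | false | true  = m≤n⇒m≤1+n (countB-mono (r⊆s ∘ suc))
... | false | false = countB-mono (r⊆s ∘ suc)

countB-mono-< : ∀ {n} {r s : Fin n → Bool} → (∀ i → r i ≡ true → s i ≡ true) →
                ∀ {a} → r a ≡ false → s a ≡ true → countB r < countB s
countB-mono-< {suc n} {r} {s} r⊆s {zero} ra sa rewrite ra | sa = s≤s (countB-mono (r⊆s ∘ suc))
countB-mono-< {suc n} {r} {s} r⊆s {suc a} ra sa with r zero in r₀ | s zero in s₀
... | true  | true  = s≤s (countB-mono-< (r⊆s ∘ suc) ra sa)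
... | true  | false = contradiction (r⊆s zero r₀) (not-¬ s₀)
... | false | true  = m≤n⇒m≤1+n (countB-mono-< (r⊆s ∘ suc) ra sa)
... | false | false = countB-mono-< (r⊆s ∘ suc) ra sa

countB≤n : ∀ {n} (r : Fin n → Bool) → countB r ≤ n
countB≤n {zero}  r = z≤n
countB≤n {suc n} r with r zero
... | true  = s≤s (countB≤n (r ∘ suc))
... | false = m≤n⇒m≤1+n (countB≤n (r ∘ suc))

absent+countB≤n : ∀ {n} (r : Fin n → Bool) (xs : List (Fin n)) → Unique xs →
                  All (λ i → r i ≡ false) xs → length xs + countB r ≤ n
absent+countB≤n r []       _                  _          = countB≤n r
absent+countB≤n r (x ∷ xs) (x∉xs ∷ xs-unique) (rx ∷ rxs) = begin-strict
  length xs + countB r   <⟨ +-monoʳ-< (length xs) (countB-mono-< r⊆r′ rx r′x) ⟩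
  length xs + countB r′  ≤⟨ absent+countB≤n r′ xs xs-unique (All.zipWith r′-absent (x∉xs , rxs)) ⟩
  _                      ∎
  where
  open ≤-Reasoning
  r′ : Fin _ → Bool
  r′ i = r i ∨ does (i ≟ x)
  r⊆r′ : ∀ i → r i ≡ true → r′ i ≡ true
  r⊆r′ i ri rewrite ri = refl
  r′x : r′ x ≡ true
  r′x rewrite rx | dec-true (x ≟ x) refl = refl
  r′-absent : ∀ {i} → x ≢ i × r i ≡ false → r′ i ≡ false
  r′-absent {i} (x≢i , ri) rewrite ri | dec-false (i ≟ x) (x≢i ∘ ≡.sym) = refl

transpose-matchˡ : ∀ {n} (i j : Fin n) → PC.transpose i j i ≡ j
transpose-matchˡ i j rewrite dec-true (i ≟ i) refl = refl

transpose-matchʳ : ∀ {n} (i j : Fin n) → PC.transpose i j j ≡ i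
transpose-matchʳ i j with j ≟ i
... | yes j≡i = j≡i
... | no  _   rewrite dec-true (j ≟ j) refl = refl

transpose-other : ∀ {n} {i j k : Fin n} → k ≢ i → k ≢ j → PC.transpose i j k ≡ k
transpose-other {i = i} {j} {k} k≢i k≢j rewrite dec-false (k ≟ i) k≢i | dec-false (k ≟ j) k≢j = refl

cycle₄ : ∀ {n} → Fin n → Fin n → Fin n → Fin n → Permutation′ n
cycle₄ a b c d = transpose c d ∘ₚ transpose b c ∘ₚ transpose a b

module _ {n} {a b c d : Fin n} where

  cycle₄-a : a ≢ b → a ≢ c → a ≢ d → cycle₄ a b c d ⟨$⟩ʳ a ≡ b
  cycle₄-a a≢b a≢c a≢d rewrite transpose-other a≢c a≢d | transpose-other a≢b a≢c = transpose-matchˡ a b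

  cycle₄-b : a ≢ c → b ≢ c → b ≢ d → cycle₄ a b c d ⟨$⟩ʳ b ≡ c
  cycle₄-b a≢c b≢c b≢d rewrite transpose-other b≢c b≢d | transpose-matchˡ b c =
    transpose-other (≢-sym a≢c) (≢-sym b≢c)

  cycle₄-c : a ≢ d → b ≢ d → c ≢ d → cycle₄ a b c d ⟨$⟩ʳ c ≡ d
  cycle₄-c a≢d b≢d c≢d rewrite transpose-matchˡ c d | transpose-other (≢-sym b≢d) (≢-sym c≢d) =
    transpose-other (≢-sym a≢d) (≢-sym b≢d)

  cycle₄-d : cycle₄ a b c d ⟨$⟩ʳ d ≡ a
  cycle₄-d rewrite transpose-matchʳ c d | transpose-matchʳ b c = transpose-matchʳ a b

  cycle₄-other : ∀ {k} → k ≢ a → k ≢ b → k ≢ c → k ≢ d → cycle₄ a b c d ⟨$⟩ʳ k ≡ k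
  cycle₄-other k≢a k≢b k≢c k≢d rewrite transpose-other k≢c k≢d | transpose-other k≢b k≢c =
    transpose-other k≢a k≢b

⟨$⟩ʳ-injective : ∀ {n} (π : Permutation′ n) {a b} → π ⟨$⟩ʳ a ≡ π ⟨$⟩ʳ b → a ≡ b
⟨$⟩ʳ-injective π e = trans (≡.sym (inverseˡ π)) (trans (cong (π ⟨$⟩ˡ_) e) (inverseˡ π))

⟨$⟩ˡ-injective : ∀ {n} (π : Permutation′ n) {a b} → π ⟨$⟩ˡ a ≡ π ⟨$⟩ˡ b → a ≡ b
⟨$⟩ˡ-injective π e = trans (≡.sym (inverseʳ π)) (trans (cong (π ⟨$⟩ʳ_) e) (inverseʳ π))

module _ {n} (T : Graph n) where

  Adj-sym : ∀ {a b} → Adj T a b → Adj T b a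
  Adj-sym {a} {b} ab = trans (sym T b a) ab

  Adj⇒≢ : ∀ {a b} → Adj T a b → a ≢ b
  Adj⇒≢ {a} ab refl = not-¬ (irrefl T a) ab

  TriangleFree : Set
  TriangleFree = ∀ {a b c} → Adj T a b → Adj T b c → Adj T c a → ⊥

  SquareFree : Set
  SquareFree = ∀ {a b c d} → Adj T a b → Adj T b c → Adj T c d → Adj T d a → a ≢ c → b ≢ d → ⊥

  Dominating : Fin n → Set
  Dominating c = ∀ w → w ≢ c → Adj T c w

  acyclic⇒triangle-free : Acyclic T → TriangleFree
  acyclic⇒triangle-free acyclic ab bc ca = acyclic record
    { first = _ ; rest = _ ∷ _ ∷ [] ; long = s≤s (s≤s z≤n)
    ; dist  = (Adj⇒≢ ab ∷ Adj⇒≢ (Adj-sym ca) ∷ []) ∷ (Adj⇒≢ bc ∷ []) ∷ [] ∷ []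
    ; links = ab ∷ bc ∷ [-]
    ; close = λ { _ refl → ca } }

  acyclic⇒square-free : Acyclic T → SquareFree
  acyclic⇒square-free acyclic ab bc cd da a≢c b≢d = acyclic record
    { first = _ ; rest = _ ∷ _ ∷ _ ∷ [] ; long = s≤s (s≤s z≤n)
    ; dist  = (Adj⇒≢ ab ∷ a≢c ∷ Adj⇒≢ (Adj-sym da) ∷ []) ∷ (Adj⇒≢ bc ∷ b≢d ∷ [])
            ∷ (Adj⇒≢ cd ∷ []) ∷ [] ∷ []
    ; links = ab ∷ bc ∷ cd ∷ [-]
    ; close = λ { _ refl → da } }

dominating⇒≅star : ∀ {m} (T : Graph (suc m)) → TriangleFree T → ∀ {c} → Dominating T c → T ≅ star m
dominating⇒≅star {m} T triangle-free {c} dominating = record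
  { to      = τ
  ; from    = PC.transpose zero c
  ; from∘to = λ _ → PC.transpose-inverse zero c
  ; to∘from = λ _ → PC.transpose-inverse c zero
  ; pres    = preserves
  }
  where
  τ : Fin (suc m) → Fin (suc m)
  τ = PC.transpose c zero

  τ≡zero : ∀ {a} → τ a ≡ zero → a ≡ c
  τ≡zero e = trans (≡.sym (PC.transpose-inverse zero c))
                   (trans (cong (PC.transpose zero c) e) (transpose-matchˡ zero c))

  τ≡suc : ∀ {a i} → τ a ≡ suc i → a ≢ c
  τ≡suc e refl with () ← trans (≡.sym (transpose-matchˡ c zero)) e

  preserves : ∀ a b → starAdj (τ a) (τ b) ≡ adj T a b
  preserves a b with τ a in τa | τ b in τb
  ... | zero  | zero  with refl ← τ≡zero {a} τa | refl ← τ≡zero {b} τb = ≡.sym (irrefl T c)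
  ... | zero  | suc _ with refl ← τ≡zero {a} τa = ≡.sym (dominating b (τ≡suc {b} τb))
  ... | suc _ | zero  with refl ← τ≡zero {b} τb = ≡.sym (Adj-sym T (dominating a (τ≡suc {a} τa)))
  ... | suc _ | suc _ = ≡.sym (¬-not λ ab →
        triangle-free (dominating a (τ≡suc {a} τa)) ab (Adj-sym T (dominating b (τ≡suc {b} τb))))

module Packing {n} (T : Graph n) (triangle-free : TriangleFree T) (square-free : SquareFree T)
               (no-dominating : ∀ c → ¬ Dominating T c)
               (p : Fin n → Fin n) (p-involutive : Involutive _≡_ p) where

  open import Data.List.Membership.DecPropositional (_≟_ {n}) using (_∈?_)

  p-inverse : ∀ {x y} → p x ≡ y → p y ≡ x
  p-inverse {x} px≡y = trans (cong p (≡.sym px≡y)) (p-involutive x)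

  p-avoids : ∀ {x y w} → p x ≡ y → w ≢ y → p w ≢ x
  p-avoids px≡y w≢y pw≡x = w≢y (trans (≡.sym (p-inverse pw≡x)) px≡y)

  conflict : Permutation′ n → Fin n → Bool
  conflict π x = adj T (π ⟨$⟩ʳ x) (π ⟨$⟩ʳ p x)

  conflicts : Permutation′ n → ℕ
  conflicts π = countB (conflict π)

  conflict-p : ∀ π x → conflict π (p x) ≡ conflict π x
  conflict-p π x = trans (cong (adj T (π ⟨$⟩ʳ p x) ∘ (π ⟨$⟩ʳ_)) (p-involutive x)) (sym T _ _)

  conflict-fixed : ∀ π {x} → p x ≡ x → conflict π x ≡ false
  conflict-fixed π {x} px≡x = trans (cong (adj T (π ⟨$⟩ʳ x) ∘ (π ⟨$⟩ʳ_)) px≡x) (irrefl T _)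

  triangle-free⇒no-conflict : ∀ π π′ {q c c′} → Adj T c c′ → Adj T c′ (π ⟨$⟩ʳ p q) →
                              π′ ⟨$⟩ʳ q ≡ c → (p q ≢ q → π′ ⟨$⟩ʳ p q ≡ π ⟨$⟩ʳ p q) →
                              conflict π′ q ≡ false
  triangle-free⇒no-conflict π π′ {q} cc′ c′-pq π′q≡c keeps-pq with p q ≟ q
  ... | yes pq≡q = conflict-fixed π′ pq≡q
  ... | no  pq≢q = trans (cong₂ (adj T) π′q≡c (keeps-pq pq≢q))
                         (¬-not λ c-pq → triangle-free cc′ c′-pq (Adj-sym T c-pq))

  fewer-conflicts : ∀ π π′ (S : List (Fin n)) → (∀ q → q ∉ S → π′ ⟨$⟩ʳ q ≡ π ⟨$⟩ʳ q) →
                    All (λ q → conflict π′ q ≡ false) S →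
                    ∀ {x} → x ∈ S → conflict π x ≡ true → conflicts π′ < conflicts π
  fewer-conflicts π π′ S agree resolved x∈S = countB-mono-< persists (All.lookup resolved x∈S)
    where
    persists : ∀ q → conflict π′ q ≡ true → conflict π q ≡ true
    persists q c′q with q ∈? S | p q ∈? S
    ... | yes q∈S | _        = contradiction c′q (not-¬ (All.lookup resolved q∈S))
    ... | no _    | yes pq∈S =
      contradiction c′q (not-¬ (trans (≡.sym (conflict-p π′ q)) (All.lookup resolved pq∈S)))
    ... | no q∉S  | no pq∉S  = trans (≡.sym (cong₂ (adj T) (agree q q∉S) (agree (p q) pq∉S))) c′q

  Blocked : Permutation′ n → Fin n → Fin n → Set
  Blocked π x y = ∀ w → w ≢ x → w ≢ y →
                  Adj T (π ⟨$⟩ʳ x) (π ⟨$⟩ʳ w) ⊎ Adj T (π ⟨$⟩ʳ y) (π ⟨$⟩ʳ p w)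

  blocked-flip : ∀ π {x y} → p x ≡ y → Blocked π x y → Blocked π y x
  blocked-flip π px≡y blocked w w≢y w≢x =
    swap (map₂ (subst (Adj T _ ∘ (π ⟨$⟩ʳ_)) (p-involutive w))
               (blocked (p w) (p-avoids px≡y w≢y) (p-avoids (p-inverse px≡y) w≢x)))

  blocked-propagates : ∀ π {x y w} → Adj T (π ⟨$⟩ʳ x) (π ⟨$⟩ʳ y) → Blocked π x y →
                       w ≢ x → w ≢ y → Adj T (π ⟨$⟩ʳ y) (π ⟨$⟩ʳ w) → Adj T (π ⟨$⟩ʳ y) (π ⟨$⟩ʳ p w)
  blocked-propagates π uv blocked w≢x w≢y vw with blocked _ w≢x w≢y
  ... | inj₁ uw  = contradiction (Adj-sym T uw) (triangle-free uv vw)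
  ... | inj₂ vpw = vpw

  other-neighbour : ∀ π {x y} → p x ≡ y → Adj T (π ⟨$⟩ʳ x) (π ⟨$⟩ʳ y) → Blocked π x y →
                    ∃ λ t → t ≢ x × t ≢ y × Adj T (π ⟨$⟩ʳ y) (π ⟨$⟩ʳ t)
  other-neighbour π {x} {y} px≡y uv blocked
    with any? (λ t → ¬? (t ≟ x) ×-dec ¬? (t ≟ y) ×-dec adj T (π ⟨$⟩ʳ y) (π ⟨$⟩ʳ t) ≟ᵇ true)
  ... | yes found = found
  ... | no  none  = contradiction dominating (no-dominating _)
    where
    adjacent : ∀ s → s ≢ x → Adj T (π ⟨$⟩ʳ x) (π ⟨$⟩ʳ s)
    adjacent s s≢x with s ≟ y | blocked s s≢x
    ... | yes refl | _         = uv
    ... | no  s≢y  | blocked-s with blocked-s s≢y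
    ...   | inj₁ us  = us
    ...   | inj₂ vps = contradiction (p s , p-avoids px≡y s≢y , p-avoids (p-inverse px≡y) s≢x , vps) none

    dominating : Dominating T (π ⟨$⟩ʳ x)
    dominating w w≢u = subst (Adj T _) (inverseʳ π) (adjacent (π ⟨$⟩ˡ w) λ π⁻¹w≡x →
      w≢u (trans (≡.sym (inverseʳ π)) (cong (π ⟨$⟩ʳ_) π⁻¹w≡x)))

  module Improve (π : Permutation′ n) (x : Fin n) (cx : conflict π x ≡ true) where

    y u v : Fin n
    y = p x
    u = π ⟨$⟩ʳ x
    v = π ⟨$⟩ʳ y

    x≢y : x ≢ y
    x≢y = Adj⇒≢ T cx ∘ cong (π ⟨$⟩ʳ_)

    Improvement : Set
    Improvement = ∃ λ π′ → conflicts π′ < conflicts π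

    Swappable : Fin n → Set
    Swappable w = w ≢ x × w ≢ y × adj T u (π ⟨$⟩ʳ w) ≡ false × adj T v (π ⟨$⟩ʳ p w) ≡ false

    swappable? : ∀ w → Dec (Swappable w)
    swappable? w = ¬? (w ≟ x) ×-dec ¬? (w ≟ y) ×-dec
                   adj T u (π ⟨$⟩ʳ w) ≟ᵇ false ×-dec adj T v (π ⟨$⟩ʳ p w) ≟ᵇ false

    transposition : ∀ {w} → Swappable w → Improvement
    transposition {w} (w≢x , w≢y , u≁w , v≁pw) =
      π′ , fewer-conflicts π π′ (x ∷ y ∷ w ∷ []) agree
                           (resolved-x ∷ resolved-y ∷ resolved-w ∷ []) (here refl) cx
      where
      π′ : Permutation′ n
      π′ = transpose y w ∘ₚ π

      agree : ∀ q → q ∉ x ∷ y ∷ w ∷ [] → π′ ⟨$⟩ʳ q ≡ π ⟨$⟩ʳ q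
      agree q q∉S = cong (π ⟨$⟩ʳ_)
        (transpose-other (q∉S ∘ there ∘ here) (q∉S ∘ there ∘ there ∘ here))

      resolved-x : conflict π′ x ≡ false
      resolved-x = trans (cong₂ (adj T) (cong (π ⟨$⟩ʳ_) (transpose-other x≢y (≢-sym w≢x)))
                                        (cong (π ⟨$⟩ʳ_) (transpose-matchˡ y w)))
                         u≁w

      resolved-y : conflict π′ y ≡ false
      resolved-y = trans (conflict-p π′ x) resolved-x

      resolved-w : conflict π′ w ≡ false
      resolved-w with p w ≟ w
      ... | yes pw≡w = conflict-fixed π′ pw≡w
      ... | no  pw≢w = trans
        (cong₂ (adj T) (cong (π ⟨$⟩ʳ_) (transpose-matchʳ y w))
                       (cong (π ⟨$⟩ʳ_) (transpose-other (p-avoids (p-involutive x) w≢x) pw≢w)))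
        v≁pw

    rotation : Blocked π x y → ∀ {z t} → z ≢ x → z ≢ y → Adj T u (π ⟨$⟩ʳ z) →
               t ≢ x → t ≢ y → Adj T v (π ⟨$⟩ʳ t) → Improvement
    rotation blocked {z} {t} z≢x z≢y uz t≢x t≢y vt =
      π′ , fewer-conflicts π π′ (x ∷ y ∷ z ∷ t ∷ []) agree
                           (resolved-x ∷ resolved-y ∷ resolved-z ∷ resolved-t ∷ []) (here refl) cx
      where
      z≢t : z ≢ t
      z≢t refl = triangle-free cx vt (Adj-sym T uz)

      π′ : Permutation′ n
      π′ = cycle₄ x z y t ∘ₚ π

      agree′ : ∀ {q} → q ≢ x → q ≢ y → q ≢ z → q ≢ t → π′ ⟨$⟩ʳ q ≡ π ⟨$⟩ʳ q
      agree′ q≢x q≢y q≢z q≢t = cong (π ⟨$⟩ʳ_) (cycle₄-other q≢x q≢z q≢y q≢t)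

      agree : ∀ q → q ∉ x ∷ y ∷ z ∷ t ∷ [] → π′ ⟨$⟩ʳ q ≡ π ⟨$⟩ʳ q
      agree q q∉S = agree′ (q∉S ∘ here) (q∉S ∘ there ∘ here)
                           (q∉S ∘ there ∘ there ∘ here) (q∉S ∘ there ∘ there ∘ there ∘ here)

      u-pz : Adj T u (π ⟨$⟩ʳ p z)
      u-pz = blocked-propagates π (Adj-sym T cx) (blocked-flip π refl blocked) z≢y z≢x uz

      v-pt : Adj T v (π ⟨$⟩ʳ p t)
      v-pt = blocked-propagates π cx blocked t≢x t≢y vt

      resolved-x : conflict π′ x ≡ false
      resolved-x = trans
        (cong₂ (adj T) (cong (π ⟨$⟩ʳ_) (cycle₄-a (≢-sym z≢x) x≢y (≢-sym t≢x)))
                       (cong (π ⟨$⟩ʳ_) (cycle₄-c (≢-sym t≢x) z≢t (≢-sym t≢y))))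
        (¬-not λ zt → square-free uz zt (Adj-sym T vt) (Adj-sym T cx)
                                  (≢-sym t≢x ∘ ⟨$⟩ʳ-injective π) (z≢y ∘ ⟨$⟩ʳ-injective π))

      resolved-y : conflict π′ y ≡ false
      resolved-y = trans (conflict-p π′ x) resolved-x

      resolved-z : conflict π′ z ≡ false
      resolved-z = triangle-free⇒no-conflict π π′ (Adj-sym T cx) u-pz
        (cong (π ⟨$⟩ʳ_) (cycle₄-b x≢y z≢y z≢t))
        (λ pz≢z → agree′ (p-avoids refl z≢y) (p-avoids (p-involutive x) z≢x) pz≢z pz≢t)
        where
        pz≢t : p z ≢ t
        pz≢t pz≡t = triangle-free cx vt (Adj-sym T (subst (Adj T u ∘ (π ⟨$⟩ʳ_)) pz≡t u-pz))

      resolved-t : conflict π′ t ≡ false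
      resolved-t = triangle-free⇒no-conflict π π′ cx v-pt
        (cong (π ⟨$⟩ʳ_) (cycle₄-d {a = x} {z} {y} {t}))
        (λ pt≢t → agree′ (p-avoids refl t≢y) (p-avoids (p-involutive x) t≢x) pt≢z pt≢t)
        where
        pt≢z : p t ≢ z
        pt≢z pt≡z = triangle-free cx (subst (Adj T v ∘ (π ⟨$⟩ʳ_)) pt≡z v-pt) (Adj-sym T uz)

    unswappable⇒blocked : (∀ w → ¬ Swappable w) → Blocked π x y
    unswappable⇒blocked none w w≢x w≢y with adj T u (π ⟨$⟩ʳ w) in uw | adj T v (π ⟨$⟩ʳ p w) in vpw
    ... | true  | _     = inj₁ refl
    ... | false | true  = inj₂ refl
    ... | false | false = contradiction (w≢x , w≢y , uw , vpw) (none w)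

    improve : Improvement
    improve with any? swappable?
    ... | yes (w , w-swappable) = transposition w-swappable
    ... | no  none =
      let blocked            = unswappable⇒blocked (λ w w-swappable → none (w , w-swappable))
          t , t≢x , t≢y , vt = other-neighbour π refl cx blocked
          z , z≢y , z≢x , uz = other-neighbour π (p-involutive x) (Adj-sym T cx) (blocked-flip π refl blocked)
      in  rotation blocked z≢x z≢y uz t≢x t≢y vt

  conflict-free : ∃ λ π → ∀ x → conflict π x ≡ false
  conflict-free = resolve id (<-wellFounded _)
    where
    resolve : ∀ π → Acc _<_ (conflicts π) → ∃ λ π → ∀ x → conflict π x ≡ false
    resolve π (acc smaller) with any? (λ x → conflict π x ≟ᵇ true)
    ... | no  none     = π , λ x → ¬-not (λ cx → none (x , cx))
    ... | yes (x , cx) with Improve.improve π x cx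
    ...   | π′ , fewer = resolve π′ (smaller fewer)

AtMostOneNonNeighbour : ∀ {n} → Graph n → Set
AtMostOneNonNeighbour G =
  ∀ {x y z} → y ≢ x → z ≢ x → adj G x y ≡ false → adj G x z ≡ false → y ≡ z

min-degree⇒at-most-one-non-neighbour : ∀ {n} (G : Graph n) → MinDegree≥ G (n ∸ 2) →
                                       AtMostOneNonNeighbour G
min-degree⇒at-most-one-non-neighbour {n} G δ {x} {y} {z} y≢x z≢x x≁y x≁z with y ≟ z
... | yes y≡z = y≡z
... | no  y≢z = contradiction (begin-strict
  2 + (n ∸ 2)     <⟨ s≤s (s≤s (s≤s (δ x))) ⟩
  3 + degree G x  ≤⟨ absent+countB≤n (adj G x) (x ∷ y ∷ z ∷ []) distinct absent ⟩
  n               ≤⟨ m≤n+m∸n n 2 ⟩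
  2 + (n ∸ 2)     ∎) (n≮n _)
  where
  open ≤-Reasoning
  distinct : Unique (x ∷ y ∷ z ∷ [])
  distinct = (≢-sym y≢x ∷ ≢-sym z≢x ∷ []) ∷ (y≢z ∷ []) ∷ [] ∷ []
  absent : All (λ i → adj G x i ≡ false) (x ∷ y ∷ z ∷ [])
  absent = irrefl G x ∷ x≁y ∷ x≁z ∷ []

module Partner {n} (G : Graph n) (at-most-one : AtMostOneNonNeighbour G) where

  NonNeighbour : Fin n → Fin n → Set
  NonNeighbour x y = y ≢ x × adj G x y ≡ false

  partner-spec : ∀ x → ∃ λ y → (y ≡ x ⊎ NonNeighbour x y) × (∀ {z} → NonNeighbour x z → z ≡ y)
  partner-spec x with any? (λ y → ¬? (y ≟ x) ×-dec adj G x y ≟ᵇ false)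
  ... | yes (y , y≢x , x≁y) =
    y , inj₂ (y≢x , x≁y) , λ (z≢x , x≁z) → at-most-one z≢x y≢x x≁z x≁y
  ... | no  none            = x , inj₁ refl , λ x≁z → contradiction (_ , x≁z) none

  partner : Fin n → Fin n
  partner x = proj₁ (partner-spec x)

  partner-unique : ∀ {x z} → NonNeighbour x z → z ≡ partner x
  partner-unique {x} = proj₂ (proj₂ (partner-spec x))

  partner-involutive : Involutive _≡_ partner
  partner-involutive x with proj₁ (proj₂ (partner-spec x))
  ... | inj₁ px≡x          = trans (cong partner px≡x) px≡x
  ... | inj₂ (px≢x , x≁px) = ≡.sym (partner-unique (≢-sym px≢x , trans (sym G _ x) x≁px))

  adj-unless-partner : ∀ {x y} → y ≢ x → y ≢ partner x → Adj G x y
  adj-unless-partner {x} {y} y≢x y≢px with adj G x y in x~y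
  ... | true  = refl
  ... | false = contradiction (partner-unique (y≢x , x~y)) y≢px

copy-in-co-matching : ∀ {n} (G T : Graph n) → AtMostOneNonNeighbour G →
                      TriangleFree T → SquareFree T → (∀ c → ¬ Dominating T c) → ContainsCopy G T
copy-in-co-matching G T at-most-one triangle-free square-free no-dominating =
  (π ⟨$⟩ˡ_) , ⟨$⟩ˡ-injective π , embeds
  where
  open Partner G at-most-one
  open Packing T triangle-free square-free no-dominating partner partner-involutive

  π : Permutation′ _
  π = proj₁ conflict-free

  embeds : ∀ a b → Adj T a b → Adj G (π ⟨$⟩ˡ a) (π ⟨$⟩ˡ b)
  embeds a b ab = adj-unless-partner (Adj⇒≢ T (Adj-sym T ab) ∘ ⟨$⟩ˡ-injective π) not-partner
    where
    not-partner : π ⟨$⟩ˡ b ≢ partner (π ⟨$⟩ˡ a)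
    not-partner e = not-¬ (proj₂ conflict-free (π ⟨$⟩ˡ a))
      (trans (cong₂ (adj T) (inverseʳ π) (trans (cong (π ⟨$⟩ʳ_) (≡.sym e)) (inverseʳ π))) ab)

lemma14 : (m : ℕ) → 6 ≤ suc m → (G : Graph (suc m)) → MinDegree≥ G (suc m ∸ 2) → (T : Graph (suc m)) → IsTree T → ¬ (T ≅ star m) → ContainsCopy G T
lemma14 m _ G δ T (_ , acyclic) T≇star =
  copy-in-co-matching G T (min-degree⇒at-most-one-non-neighbour G δ) triangle-free square-free
    (λ _ dominating → T≇star (dominating⇒≅star T triangle-free dominating))
  where
  triangle-free : TriangleFree T
  triangle-free = acyclic⇒triangle-free T acyclic
  square-free : SquareFree T
  square-free = acyclic⇒square-free T acyclic
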